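{- Fix $n\ge 3$ and let $\pi\in\mathcal{Q}_n$. Then: (i) $\pi(1)=n$, $\pi(2)=n$, $\pi(n)=n$, or $\pi = 3142$. (ii) The map $\sigma\mapsto n,\sigma$ is a bijection from $\mathcal{Q}_{n-1}$ onto the set of permutations in $\mathcal{Q}_n$ which begin with $n$. (iii) The map $\sigma\mapsto n-1,n,\sigma$ is a bijection from $\mathcal{Q}_{n-2}$ onto the set of permutations in $\mathcal{Q}_n$ whose second entry is $n$ and in which $n$ does not take part in the (unique) occurrence of $132$. (iv) The map $\sigma\mapsto \sigma,n$ is a bijection from $\mathcal{Q}_{n-1}$ onto the set of permutations in $\mathcal{Q}_n$ which end with $n$. (v) The map $\sigma\mapsto n-2,n,\sigma'$, where $\sigma'$ is the sequence (a permutation of $1,2,\dots,n-3,n-1$) obtained from $\sigma$ by replacing the entry $n-2$ by $n-1$, is a bijection from $\mathcal{P}_{n-2}(132)$ onto the set of permutations in $\mathcal{Q}_n$ whose second entry is $n$ and in which $n$ takes part in the (unique) occurrence of $132$.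
   Context: $S_n$ is the set of permutations of $\{1,\dots,n\}$ in one-line notation. An occurrence of a pattern $\sigma\in S_k$ in $\pi$ is a subsequence of length $k$ of $\pi$ whose entries are in the same relative order as $\sigma$; $\pi$ avoids $\sigma$ if it has no occurrence. A permutation $\pi\in S_n$ is two-stack sortable (West's characterization) if it avoids $2341$ and every occurrence $\pi(i)\pi(j)\pi(k)\pi(l)$ ($i<j<k<l$) of $3241$ extends to an occurrence of $35241$, i.e. there is $m$ with $i<m<j$ and $\pi(m)>\pi(k)$. $\mathcal{P}_n$ denotes the set of two-stack sortable permutations in $S_n$, and $\mathcal{P}_n(132)$ those which also avoid $132$ (equivalently, the permutations in $S_n$ avoiding $132$, $2341$, $3241$); $\mathcal{P}_0(132)$ contains only the empty permutation. $\mathcal{Q}_n$ denotes the set of permutations in $\mathcal{P}_n$ containing exactly one occurrence of $132$. Commas denote concatenation. -}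

module Defs where

open import Data.Nat using (ℕ; zero; suc; _∸_; _≡ᵇ_) renaming (_<_ to _<ℕ_)
open import Data.Fin using (Fin) renaming (_<_ to _<F_)
open import Data.Bool using (if_then_else_)
open import Data.List using (List; []; _∷_; map; upTo; length; lookup)
open import Data.List.Relation.Binary.Permutation.Propositional using (_↭_)
open import Data.Product using (Σ; ∃; _×_; _,_; proj₁)
open import Relation.Nullary using (¬_)
open import Relation.Binary.PropositionalEquality using (_≡_; _≗_)

IsPerm : ℕ → List ℕ → Set
IsPerm n π = π ↭ map suc (upTo n)

record Occ (σ π : List ℕ) : Set where
  field
    pos     : Fin (length σ) → Fin (length π)
    incr    : ∀ a b → a <F b → pos a <F pos b
    orderL  : ∀ a b → lookup σ a <ℕ lookup σ b → lookup π (pos a) <ℕ lookup π (pos b)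
    orderR  : ∀ a b → lookup π (pos a) <ℕ lookup π (pos b) → lookup σ a <ℕ lookup σ b
open Occ public

Contains : List ℕ → List ℕ → Set
Contains σ π = Occ σ π

Avoids : List ℕ → List ℕ → Set
Avoids σ π = ¬ Occ σ π

ExactlyOne : List ℕ → List ℕ → Set
ExactlyOne σ π = Σ (Occ σ π) λ o → ∀ (o' : Occ σ π) → pos o' ≗ pos o

p132 p2341 p3241 : List ℕ
p132  = 1 ∷ 3 ∷ 2 ∷ []
p2341 = 2 ∷ 3 ∷ 4 ∷ 1 ∷ []
p3241 = 3 ∷ 2 ∷ 4 ∷ 1 ∷ []

-- West's characterization of two-stack sortability.
TwoStackSortable : List ℕ → Set
TwoStackSortable π =
  Avoids p2341 π ×
  (∀ (o : Occ p3241 π) →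
     Σ (Fin (length π)) λ m →
       (pos o Fin.zero <F m) × (m <F pos o (Fin.suc Fin.zero)) ×
       (lookup π (pos o (Fin.suc (Fin.suc Fin.zero))) <ℕ lookup π m))

P : ℕ → List ℕ → Set
P n π = IsPerm n π × TwoStackSortable π

P132 : ℕ → List ℕ → Set
P132 n π = P n π × Avoids p132 π

Q : ℕ → List ℕ → Set
Q n π = P n π × ExactlyOne p132 π

NIn132 : ℕ → List ℕ → Set
NIn132 n π = Σ (Occ p132 π) λ o → ∃ λ a → lookup π (pos o a) ≡ n

BijOnto : (List ℕ → Set) → (List ℕ → Set) → (List ℕ → List ℕ) → Set
BijOnto A B f =
  (∀ σ → A σ → B (f σ)) ×
  (∀ σ τ → A σ → A τ → f σ ≡ f τ → σ ≡ τ) ×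
  (∀ π → B π → Σ (List ℕ) λ σ → A σ × f σ ≡ π)

replace : ℕ → ℕ → List ℕ → List ℕ
replace a b = map (λ x → if x ≡ᵇ a then b else x)

{-# OPTIONS --safe #-}
-- Two entries before n cannot both
-- exceed an entry after n: they would form a 2341, or a 3241 that nothing extends since no entry
-- exceeds n.  Two entries before n cannot both lie below an entry after n, since they would
-- complete two 132s.  So if n is not last, at most two entries precede it; if two precede it,
-- every later entry ends a 132 through n, so at most one follows.  The shape x y n w forces 3142.
--
-- In (ii)-(iv) the added entries exceed everything in σ and sit at an end, so every occurrence of
-- 132, 2341 or 3241 lies inside the copy of σ, a factor of the new permutation: two-stack
-- sortability and the unique 132 transfer in both directions.  In (iii) the first entry must be
-- n-1, for otherwise n-1 appears later and forms a 132 with the first entry and n.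
--
-- In (v), σ' is order-isomorphic to σ and n-2, n, σ' contains the 132 formed by n-2, n, n-1.
-- Occurrences avoiding the first entry lie in n, σ' and hence in σ'; those through the first
-- entry are this 132, an impossible 2341, or a 3241 extended by n.  Conversely, the first entry
-- is the 1 of the 132 through n, and were it below n-2, both n-2 and n-1 would complete it to a
-- 132.
module Submission where

open import Defs
open import Data.Nat using (ℕ; zero; suc; _+_; _∸_; _≤_; _<_; z≤n; s≤s; s≤s⁻¹; _≡ᵇ_; _≟_)
open import Data.Nat.Properties
open import Data.Fin as F using (Fin; zero; suc; toℕ; inject₁)
import Data.Fin.Properties as F
open import Data.Bool using (T; true; false; if_then_else_)
open import Data.List using (List; []; _∷_; _++_; [_]; _∷ʳ_; length; lookup; map; upTo)
open import Data.List.Properties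
  using (∷-injectiveʳ; ∷ʳ-injectiveˡ; upTo-∷ʳ; length-map; length-upTo; map-++; map-∘; map-id-local; ++-identityʳ)
open import Data.List.Relation.Unary.Any using (index)
open import Data.List.Relation.Unary.Any.Properties using (lookup-index)
open import Data.List.Membership.Propositional using (_∈_)
open import Data.List.Relation.Binary.Permutation.Propositional
  using (_↭_; ↭-refl; ↭-reflexive; ↭-prep; ↭-swap; ↭-trans; ↭-sym; ↭⇒↭ₛ)
open import Data.List.Relation.Binary.Permutation.Propositional.Properties
  using (∈-resp-↭; All-resp-↭; ↭-length; ∷↭∷ʳ; ++⁺ʳ; drop-∷; drop-mid; map⁺)
import Data.List.Relation.Binary.Permutation.Setoid.Properties as Permutation
import Data.List.Relation.Unary.Unique.Propositional.Properties as Unique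
open import Data.List.Relation.Unary.All as All using (All)
import Data.List.Relation.Unary.All.Properties as All
import Data.List.Relation.Unary.AllPairs as AllPairs
open import Data.List.Relation.Unary.Unique.Propositional using (Unique)
open import Data.List.Membership.Propositional.Properties
  using (∈-lookup; ∈-map⁺; ∈-map⁻; ∈-upTo⁺; ∈-upTo⁻)
open import Data.Empty using (⊥; ⊥-elim)
open import Data.Product using (Σ; ∃; _×_; _,_; proj₁; proj₂; map₂)
open import Data.Sum using (_⊎_; inj₁; inj₂)
open import Relation.Nullary using (¬_; yes; no)
open import Function using (_∘_)
open import Relation.Binary using (tri<; tri≈; tri>)
open import Relation.Binary.PropositionalEquality hiding ([_])
open import Relation.Nullary.Decidable using (True; toWitness)

infixl 9 _!_
_!_ : (π : List ℕ) → Fin (length π) → ℕ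
_!_ = lookup

increasing-by-steps : ∀ {k} (f : Fin (suc k) → ℕ) → (∀ i → f (inject₁ i) < f (suc i)) →
  ∀ {a b} → a F.< b → f a < f b
increasing-by-steps f step {zero} {suc zero} _ = step zero
increasing-by-steps {suc k} f step {zero} {suc (suc b)} _ =
  <-trans (step zero) (increasing-by-steps (f ∘ suc) (step ∘ suc) {zero} {suc b} (s≤s z≤n))
increasing-by-steps {suc k} f step {suc a} {suc b} (s≤s a<b) = increasing-by-steps (f ∘ suc) (step ∘ suc) a<b

reflects-< : ∀ {m} {f : Fin m → ℕ} → (∀ {a b} → a F.< b → f a < f b) →
  ∀ {a b} → f a < f b → a F.< b
reflects-< f-mono {a} {b} lt with F.<-cmp a b
... | tri< a<b _ _ = a<b
... | tri≈ _ refl _ = ⊥-elim (<-irrefl refl lt)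
... | tri> _ _ b<a = ⊥-elim (<-asym lt (f-mono b<a))

-- An occurrence of a pattern s ∷ σ ∈ S_k is certified by its positions ps together with the
-- pattern indices listed by increasing value (byValue, with inverse rank): then only the k - 1
-- adjacent comparisons of positions and of values remain.  The two implicit side conditions are
-- closed by evaluation for every concrete pattern.
mkOcc : ∀ {s σ π} (ps : Fin (suc (length σ)) → Fin (length π))
  (byValue rank : Fin (suc (length σ)) → Fin (suc (length σ))) →
  {_ : True (F.all? λ a → byValue (rank a) F.≟ a)} →
  {_ : True (F.all? λ a → (s ∷ σ) ! a ≟ suc (toℕ (rank a)))} →
  (∀ i → ps (inject₁ i) F.< ps (suc i)) →
  (∀ v → π ! ps (byValue (inject₁ v)) < π ! ps (byValue (suc v))) →
  Occ (s ∷ σ) π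
mkOcc {s} {σ} {π} ps byValue rank {inverse} {ranked} pos-step value-step = record
  { pos = ps
  ; incr = λ _ _ → increasing-by-steps (toℕ ∘ ps) pos-step
  ; orderL = λ a b lt →
      subst₂ _<_ (at-rank a) (at-rank b) (value-mono (s≤s⁻¹ (subst₂ _<_ (entry a) (entry b) lt)))
  ; orderR = λ a b lt → subst₂ _<_ (sym (entry a)) (sym (entry b))
      (s≤s (reflects-< value-mono (subst₂ _<_ (sym (at-rank a)) (sym (at-rank b)) lt))) }
  where
  value : Fin (suc (length σ)) → ℕ
  value v = π ! ps (byValue v)
  value-mono : ∀ {v w} → v F.< w → value v < value w
  value-mono = increasing-by-steps value value-step
  at-rank : ∀ a → value (rank a) ≡ π ! ps a
  at-rank a = cong (λ x → π ! ps x) (toWitness inverse a)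
  entry : ∀ a → (s ∷ σ) ! a ≡ suc (toℕ (rank a))
  entry = toWitness ranked

132-at : ∀ π (i j k : Fin (length π)) → i F.< j → j F.< k → π ! i < π ! k → π ! k < π ! j →
  Occ p132 π
132-at π i j k i<j j<k πi<πk πk<πj =
  mkOcc ps byValue byValue (λ { zero → i<j ; (suc zero) → j<k }) (λ { zero → πi<πk ; (suc zero) → πk<πj })
  where
  ps : Fin 3 → Fin (length π)
  ps = λ { zero → i ; (suc zero) → j ; (suc (suc zero)) → k }
  byValue : Fin 3 → Fin 3
  byValue = λ { zero → zero ; (suc zero) → suc (suc zero) ; (suc (suc zero)) → suc zero }

2341-at : ∀ π (i j k l : Fin (length π)) → i F.< j → j F.< k → k F.< l →
  π ! l < π ! i → π ! i < π ! j → π ! j < π ! k → Occ p2341 π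
2341-at π i j k l i<j j<k k<l πl<πi πi<πj πj<πk =
  mkOcc ps byValue rank (λ { zero → i<j ; (suc zero) → j<k ; (suc (suc zero)) → k<l })
    (λ { zero → πl<πi ; (suc zero) → πi<πj ; (suc (suc zero)) → πj<πk })
  where
  ps : Fin 4 → Fin (length π)
  ps = λ { zero → i ; (suc zero) → j ; (suc (suc zero)) → k ; (suc (suc (suc zero))) → l }
  byValue rank : Fin 4 → Fin 4
  byValue = λ { zero → suc (suc (suc zero)) ; (suc zero) → zero
              ; (suc (suc zero)) → suc zero ; (suc (suc (suc zero))) → suc (suc zero) }
  rank = λ { zero → suc zero ; (suc zero) → suc (suc zero)
           ; (suc (suc zero)) → suc (suc (suc zero)) ; (suc (suc (suc zero))) → zero }

3241-at : ∀ π (i j k l : Fin (length π)) → i F.< j → j F.< k → k F.< l →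
  π ! l < π ! j → π ! j < π ! i → π ! i < π ! k → Occ p3241 π
3241-at π i j k l i<j j<k k<l πl<πj πj<πi πi<πk =
  mkOcc ps byValue rank (λ { zero → i<j ; (suc zero) → j<k ; (suc (suc zero)) → k<l })
    (λ { zero → πl<πj ; (suc zero) → πj<πi ; (suc (suc zero)) → πi<πk })
  where
  ps : Fin 4 → Fin (length π)
  ps = λ { zero → i ; (suc zero) → j ; (suc (suc zero)) → k ; (suc (suc (suc zero))) → l }
  byValue rank : Fin 4 → Fin 4
  byValue = λ { zero → suc (suc (suc zero)) ; (suc zero) → suc zero
              ; (suc (suc zero)) → zero ; (suc (suc (suc zero))) → suc (suc zero) }
  rank = λ { zero → suc (suc zero) ; (suc zero) → suc zero
           ; (suc (suc zero)) → suc (suc (suc zero)) ; (suc (suc (suc zero))) → zero }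

index≤pos : ∀ {σ π} (o : Occ σ π) a → toℕ a ≤ toℕ (pos o a)
index≤pos o a = go (toℕ a) a refl
  where
  go : ∀ n a → toℕ a ≡ n → n ≤ toℕ (pos o a)
  go zero a _ = z≤n
  go (suc n) a a≡1+n = <-≤-trans (s≤s (go n a′ (F.toℕ-fromℕ< n<len))) (incr o a′ a a′<a)
    where
    n<len = <-≤-trans (≤-reflexive (sym a≡1+n)) (<⇒≤ (F.toℕ<n a))
    a′ = F.fromℕ< n<len
    a′<a : a′ F.< a
    a′<a = ≤-reflexive (trans (cong suc (F.toℕ-fromℕ< n<len)) (sym a≡1+n))

pos-mono : ∀ {σ π} (o : Occ σ π) {a b} → a F.≤ b → toℕ (pos o a) ≤ toℕ (pos o b)
pos-mono o {a} {b} a≤b with m≤n⇒m<n∨m≡n a≤b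
... | inj₁ a<b = <⇒≤ (incr o a b a<b)
... | inj₂ a≡b rewrite F.toℕ-injective a≡b = ≤-refl

first-pos : ∀ {m} (j : Fin (suc m)) → toℕ j < 1 → j ≡ zero
first-pos zero _ = refl
first-pos (suc j) (s≤s ())

rightPos : ∀ (α τ : List ℕ) → Fin (length τ) → Fin (length (α ++ τ))
rightPos [] τ i = i
rightPos (x ∷ α) τ i = suc (rightPos α τ i)

toℕ-rightPos : ∀ (α τ : List ℕ) i → toℕ (rightPos α τ i) ≡ length α + toℕ i
toℕ-rightPos [] τ i = refl
toℕ-rightPos (x ∷ α) τ i = cong suc (toℕ-rightPos α τ i)

lookup-rightPos : ∀ (α τ : List ℕ) i → (α ++ τ) ! rightPos α τ i ≡ τ ! i
lookup-rightPos [] τ i = refl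
lookup-rightPos (x ∷ α) τ i = lookup-rightPos α τ i

rightPos-onto : ∀ (α τ : List ℕ) (j : Fin (length (α ++ τ))) → length α ≤ toℕ j →
  Σ (Fin (length τ)) λ i → rightPos α τ i ≡ j
rightPos-onto [] τ j _ = j , refl
rightPos-onto (x ∷ α) τ (suc j) (s≤s α≤j) = map₂ (cong suc) (rightPos-onto α τ j α≤j)

lookup-++-left : ∀ {P : ℕ → Set} (α τ : List ℕ) → All P α →
  (j : Fin (length (α ++ τ))) → toℕ j < length α → P ((α ++ τ) ! j)
lookup-++-left (x ∷ α) τ (px All.∷ _) zero _ = px
lookup-++-left (x ∷ α) τ (_ All.∷ pα) (suc j) (s≤s j<α) = lookup-++-left α τ pα j j<α

leftPos : ∀ (τ β : List ℕ) → Fin (length τ) → Fin (length (τ ++ β))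
leftPos (x ∷ τ) β zero = zero
leftPos (x ∷ τ) β (suc i) = suc (leftPos τ β i)

toℕ-leftPos : ∀ (τ β : List ℕ) i → toℕ (leftPos τ β i) ≡ toℕ i
toℕ-leftPos (x ∷ τ) β zero = refl
toℕ-leftPos (x ∷ τ) β (suc i) = cong suc (toℕ-leftPos τ β i)

lookup-leftPos : ∀ (τ β : List ℕ) i → (τ ++ β) ! leftPos τ β i ≡ τ ! i
lookup-leftPos (x ∷ τ) β zero = refl
lookup-leftPos (x ∷ τ) β (suc i) = lookup-leftPos τ β i

leftPos-onto : ∀ (τ β : List ℕ) (j : Fin (length (τ ++ β))) → toℕ j < length τ →
  Σ (Fin (length τ)) λ i → leftPos τ β i ≡ j
leftPos-onto (x ∷ τ) β zero _ = zero , refl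
leftPos-onto (x ∷ τ) β (suc j) (s≤s j<τ) = let i , i≡j = leftPos-onto τ β j j<τ in suc i , cong suc i≡j

lookup-++-right : ∀ {P : ℕ → Set} (τ β : List ℕ) → All P β →
  (j : Fin (length (τ ++ β))) → length τ ≤ toℕ j → P ((τ ++ β) ! j)
lookup-++-right [] β pβ j _ = All.lookup pβ (∈-lookup j)
lookup-++-right (x ∷ τ) β pβ (suc j) (s≤s τ≤j) = lookup-++-right τ β pβ j τ≤j

mapPos : ∀ (g : ℕ → ℕ) (σ : List ℕ) → Fin (length σ) → Fin (length (map g σ))
mapPos g (x ∷ σ) zero = zero
mapPos g (x ∷ σ) (suc i) = suc (mapPos g σ i)

toℕ-mapPos : ∀ g (σ : List ℕ) i → toℕ (mapPos g σ i) ≡ toℕ i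
toℕ-mapPos g (x ∷ σ) zero = refl
toℕ-mapPos g (x ∷ σ) (suc i) = cong suc (toℕ-mapPos g σ i)

lookup-mapPos : ∀ g (σ : List ℕ) i → map g σ ! mapPos g σ i ≡ g (σ ! i)
lookup-mapPos g (x ∷ σ) zero = refl
lookup-mapPos g (x ∷ σ) (suc i) = lookup-mapPos g σ i

mapPos-onto : ∀ g (σ : List ℕ) (j : Fin (length (map g σ))) →
  Σ (Fin (length σ)) λ i → mapPos g σ i ≡ j
mapPos-onto g (x ∷ σ) zero = zero , refl
mapPos-onto g (x ∷ σ) (suc j) = let i , i≡j = mapPos-onto g σ j in suc i , cong suc i≡j

record Embedding (τ π : List ℕ) : Set where
  field
    ι        : Fin (length τ) → Fin (length π)
    ι-mono   : ∀ {i j} → i F.< j → ι i F.< ι j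
    ι-order  : ∀ {i j} → τ ! i < τ ! j → π ! ι i < π ! ι j
    ι-order⁻ : ∀ {i j} → π ! ι i < π ! ι j → τ ! i < τ ! j

  ι-mono⁻ : ∀ {i j} → ι i F.< ι j → i F.< j
  ι-mono⁻ = reflects-< {f = toℕ ∘ ι} ι-mono

  ι-injective : ∀ {i j} → ι i ≡ ι j → i ≡ j
  ι-injective {i} {j} eq with F.<-cmp i j
  ... | tri< i<j _ _ = ⊥-elim (<-irrefl (cong toℕ eq) (ι-mono i<j))
  ... | tri≈ _ i≡j _ = i≡j
  ... | tri> _ _ j<i = ⊥-elim (<-irrefl (cong toℕ (sym eq)) (ι-mono j<i))

  InImage : Fin (length π) → Set
  InImage j = Σ (Fin (length τ)) λ i → ι i ≡ j

  Convex : Set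
  Convex = ∀ {i j m} → ι i F.< m → m F.< ι j → InImage m

open Embedding public

embedOcc : ∀ {σ τ π} → Embedding τ π → Occ σ τ → Occ σ π
embedOcc e o = record
  { pos = ι e ∘ pos o
  ; incr = λ a b → ι-mono e ∘ incr o a b
  ; orderL = λ a b → ι-order e ∘ orderL o a b
  ; orderR = λ a b → orderR o a b ∘ ι-order⁻ e }

restrictOcc : ∀ {σ τ π} (e : Embedding τ π) (o : Occ σ π) → (∀ a → InImage e (pos o a)) → Occ σ τ
restrictOcc {σ} {τ} {π} e o inIm = record
  { pos = λ a → proj₁ (inIm a)
  ; incr = λ a b → ι-mono⁻ e ∘ subst₂ F._<_ (sym (back a)) (sym (back b)) ∘ incr o a b
  ; orderL = λ a b →
      ι-order⁻ e ∘ subst₂ (λ x y → π ! x < π ! y) (sym (back a)) (sym (back b)) ∘ orderL o a b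
  ; orderR = λ a b → orderR o a b ∘ subst₂ (λ x y → π ! x < π ! y) (back a) (back b) ∘ ι-order e }
  where
  back : ∀ a → ι e (proj₁ (inIm a)) ≡ pos o a
  back a = proj₂ (inIm a)

embedding-trans : ∀ {τ π ρ} → Embedding τ π → Embedding π ρ → Embedding τ ρ
embedding-trans e e′ = record
  { ι = ι e′ ∘ ι e
  ; ι-mono = ι-mono e′ ∘ ι-mono e
  ; ι-order = ι-order e′ ∘ ι-order e
  ; ι-order⁻ = ι-order⁻ e ∘ ι-order⁻ e′ }

rightEmbedding : ∀ α τ → Embedding τ (α ++ τ)
rightEmbedding α τ = record
  { ι = rightPos α τ
  ; ι-mono = λ {i} {j} →
      subst₂ _<_ (sym (toℕ-rightPos α τ i)) (sym (toℕ-rightPos α τ j)) ∘ +-monoʳ-< (length α)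
  ; ι-order = λ {i} {j} → subst₂ _<_ (sym (lookup-rightPos α τ i)) (sym (lookup-rightPos α τ j))
  ; ι-order⁻ = λ {i} {j} → subst₂ _<_ (lookup-rightPos α τ i) (lookup-rightPos α τ j) }

leftEmbedding : ∀ τ β → Embedding τ (τ ++ β)
leftEmbedding τ β = record
  { ι = leftPos τ β
  ; ι-mono = λ {i} {j} → subst₂ _<_ (sym (toℕ-leftPos τ β i)) (sym (toℕ-leftPos τ β j))
  ; ι-order = λ {i} {j} → subst₂ _<_ (sym (lookup-leftPos τ β i)) (sym (lookup-leftPos τ β j))
  ; ι-order⁻ = λ {i} {j} → subst₂ _<_ (lookup-leftPos τ β i) (lookup-leftPos τ β j) }

mapEmbedding : ∀ g σ → (∀ {i j} → σ ! i < σ ! j → g (σ ! i) < g (σ ! j)) → Embedding σ (map g σ)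
mapEmbedding g σ g-mono = record
  { ι = mapPos g σ
  ; ι-mono = λ {i} {j} → subst₂ _<_ (sym (toℕ-mapPos g σ i)) (sym (toℕ-mapPos g σ j))
  ; ι-order = λ {i} {j} → subst₂ _<_ (sym (lookup-mapPos g σ i)) (sym (lookup-mapPos g σ j)) ∘ g-mono
  ; ι-order⁻ = λ {i} {j} → g-reflects ∘ subst₂ _<_ (lookup-mapPos g σ i) (lookup-mapPos g σ j) }
  where
  g-reflects : ∀ {i j} → g (σ ! i) < g (σ ! j) → σ ! i < σ ! j
  g-reflects {i} {j} lt with <-cmp (σ ! i) (σ ! j)
  ... | tri< σi<σj _ _ = σi<σj
  ... | tri≈ _ σi≡σj _ = ⊥-elim (<-irrefl (cong g σi≡σj) lt)
  ... | tri> _ _ σj<σi = ⊥-elim (<-asym lt (g-mono σj<σi))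

rightEmbedding-convex : ∀ α τ → Convex (rightEmbedding α τ)
rightEmbedding-convex α τ {i} i<m _ = rightPos-onto α τ _
  (≤-trans (≤-trans (m≤m+n (length α) (toℕ i)) (≤-reflexive (sym (toℕ-rightPos α τ i)))) (<⇒≤ i<m))

-- West's condition on an occurrence of 3241: it extends to an occurrence of 35241.
Extends : ∀ π → Occ p3241 π → Set
Extends π o = Σ (Fin (length π)) λ m →
  (pos o zero F.< m) × (m F.< pos o (suc zero)) × (π ! pos o (suc (suc zero)) < π ! m)

extends-embed : ∀ {τ π} (e : Embedding τ π) (o : Occ p3241 π) (o′ : Occ p3241 τ) →
  (∀ a → ι e (pos o′ a) ≡ pos o a) → Extends τ o′ → Extends π o
extends-embed {π = π} e o o′ back (m , i<m , m<j , above) =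
  ι e m ,
  subst (F._< ι e m) (back zero) (ι-mono e i<m) ,
  subst (ι e m F.<_) (back (suc zero)) (ι-mono e m<j) ,
  subst (λ x → π ! x < π ! ι e m) (back (suc (suc zero))) (ι-order e above)

TSS-restrict : ∀ {τ π} (e : Embedding τ π) → Convex e → TwoStackSortable π → TwoStackSortable τ
TSS-restrict e convex (avoid2341 , extend3241) = avoid2341 ∘ embedOcc e , extend
  where
  extend : ∀ o → Extends _ o
  extend o with extend3241 (embedOcc e o)
  ... | m , i<m , m<j , above with convex i<m m<j
  ... | m′ , refl = m′ , ι-mono⁻ e i<m , ι-mono⁻ e m<j , ι-order⁻ e above

data Watched : List ℕ → Set where
  watch132  : Watched p132
  watch2341 : Watched p2341
  watch3241 : Watched p3241

-- τ sits in π as a factor (up to order isomorphism) containing every occurrence of the patterns in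
-- the definition of 𝒬; two-stack sortability and uniqueness of the 132 then pass between τ and π
-- in both directions.
record Cover (τ π : List ℕ) : Set where
  field
    embedding : Embedding τ π
    convex    : Convex embedding
    covers    : ∀ {σ} → Watched σ → (o : Occ σ π) → ∀ a → InImage embedding (pos o a)

  restrictWatched : ∀ {σ} → Watched σ → Occ σ π → Occ σ τ
  restrictWatched w o = restrictOcc embedding o (covers w o)

  restrictWatched-pos : ∀ {σ} (w : Watched σ) (o : Occ σ π) a →
    ι embedding (pos (restrictWatched w o) a) ≡ pos o a
  restrictWatched-pos w o a = proj₂ (covers w o a)

open Cover public

module _ {τ π} (C : Cover τ π) where
  private
    e = embedding C

  TSS-extend : TwoStackSortable τ → TwoStackSortable π
  TSS-extend (avoid2341 , extend3241) =
    avoid2341 ∘ restrictWatched C watch2341 ,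
    λ o → extends-embed e o (restrictWatched C watch3241 o) (restrictWatched-pos C watch3241 o)
            (extend3241 (restrictWatched C watch3241 o))

  unique132-extend : ExactlyOne p132 τ → ExactlyOne p132 π
  unique132-extend (o , unique) = embedOcc e o , λ o′ a →
    trans (sym (restrictWatched-pos C watch132 o′ a)) (cong (ι e) (unique (restrictWatched C watch132 o′) a))

  unique132-restrict : ExactlyOne p132 π → ExactlyOne p132 τ
  unique132-restrict (o , unique) = restrictWatched C watch132 o , λ o′ a →
    ι-injective e (trans (unique (embedOcc e o′) a) (sym (restrictWatched-pos C watch132 o a)))

  Q-extend : ∀ {m n} → IsPerm n π → Q m τ → Q n π
  Q-extend perm ((_ , tss) , unique) = (perm , TSS-extend tss) , unique132-extend unique

  Q-restrict : ∀ {m n} → IsPerm m τ → Q n π → Q m τ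
  Q-restrict perm ((_ , tss) , unique) = (perm , TSS-restrict e (convex C) tss) , unique132-restrict unique

cover-trans : ∀ {τ π ρ} → Cover τ π → Cover π ρ → Cover τ ρ
cover-trans {τ} {π} {ρ} C C′ = record
  { embedding = embedding-trans e e′
  ; convex = convex′
  ; covers = covers′ }
  where
  e = embedding C
  e′ = embedding C′
  convex′ : Convex (embedding-trans e e′)
  convex′ i<m m<j with convex C′ i<m m<j
  ... | m′ , refl with convex C (ι-mono⁻ e′ i<m) (ι-mono⁻ e′ m<j)
  ... | m″ , refl = m″ , refl
  covers′ : ∀ {σ} → Watched σ → (o : Occ σ ρ) → ∀ a → InImage (embedding-trans e e′) (pos o a)
  covers′ w o a =
    let i , ιi≡ = covers C w (restrictWatched C′ w o) a
    in i , trans (cong (ι e′) ιi≡) (restrictWatched-pos C′ w o a)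

watched-first : ∀ {σ} → Watched σ → Σ (Fin (length σ)) λ f → Σ (Fin (length σ)) λ k →
  (∀ (a : Fin (length σ)) → f F.≤ a) × 2 ≤ toℕ k × σ ! f < σ ! k
watched-first watch132  = zero , suc (suc zero) , (λ _ → z≤n) , ≤-refl , <ᵇ⇒< 1 2 _
watched-first watch2341 = zero , suc (suc zero) , (λ _ → z≤n) , ≤-refl , <ᵇ⇒< 2 4 _
watched-first watch3241 = zero , suc (suc zero) , (λ _ → z≤n) , ≤-refl , <ᵇ⇒< 3 4 _

watched-last : ∀ {σ} → Watched σ → Σ (Fin (length σ)) λ ℓ → Σ (Fin (length σ)) λ k →
  (∀ (a : Fin (length σ)) → a F.≤ ℓ) × σ ! ℓ < σ ! k
watched-last watch132  = F.fromℕ 2 , suc zero , F.≤fromℕ , <ᵇ⇒< 2 3 _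
watched-last watch2341 = F.fromℕ 3 , zero , F.≤fromℕ , <ᵇ⇒< 1 2 _
watched-last watch3241 = F.fromℕ 3 , zero , F.≤fromℕ , <ᵇ⇒< 1 3 _

-- A watched occurrence cannot start inside α: its third entry, at position ≥ 2 ≥ length α, lies in
-- τ and exceeds its first entry.
prepend-cover : ∀ α τ {B} → All (B ≤_) α → All (_< B) τ → length α ≤ 2 → Cover τ (α ++ τ)
prepend-cover α τ {B} α≥B τ<B α≤2 = record
  { embedding = rightEmbedding α τ
  ; convex = rightEmbedding-convex α τ
  ; covers = λ w o a → rightPos-onto α τ (pos o a) (starts-right w o a) }
  where
  starts-right : ∀ {σ} → Watched σ → (o : Occ σ (α ++ τ)) → ∀ a → length α ≤ toℕ (pos o a)
  starts-right w o a with watched-first w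
  ... | f , k , f≤ , 2≤k , f<k = ≤-trans (≮⇒≥ f-not-left) (pos-mono o (f≤ a))
    where
    k-right : (α ++ τ) ! pos o k < B
    k-right = lookup-++-right α τ τ<B (pos o k) (≤-trans α≤2 (≤-trans 2≤k (index≤pos o k)))
    f-not-left : ¬ toℕ (pos o f) < length α
    f-not-left f-left =
      <⇒≱ (<-trans (orderL o f k f<k) k-right) (lookup-++-left α τ α≥B (pos o f) f-left)

-- The last entry of a watched pattern is not its largest, so a watched occurrence avoids the maximum x.
append-cover : ∀ τ {x} → All (_< x) τ → Cover τ (τ ∷ʳ x)
append-cover τ {x} τ<x = record
  { embedding = leftEmbedding τ [ x ]
  ; convex = λ {_} {j} _ m<j → leftPos-onto τ [ x ] _
      (<-trans m<j (subst (_< length τ) (sym (toℕ-leftPos τ [ x ] j)) (F.toℕ<n j)))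
  ; covers = λ w o a → leftPos-onto τ [ x ] (pos o a) (ends-left w o a) }
  where
  bounded : ∀ j → (τ ∷ʳ x) ! j ≤ x
  bounded j = All.lookup (All.++⁺ (All.map <⇒≤ τ<x) (≤-refl All.∷ All.[])) (∈-lookup j)
  ends-left : ∀ {σ} → Watched σ → (o : Occ σ (τ ∷ʳ x)) → ∀ a → toℕ (pos o a) < length τ
  ends-left w o a with watched-last w
  ... | ℓ , k , ≤ℓ , ℓ<k = ≤-<-trans (pos-mono o (≤ℓ a)) (≰⇒> ℓ-not-right)
    where
    ℓ-not-right : ¬ length τ ≤ toℕ (pos o ℓ)
    ℓ-not-right ℓ-right = <⇒≱ (<-≤-trans (orderL o ℓ k ℓ<k) (bounded (pos o k)))
      (lookup-++-right {x ≤_} τ [ x ] (≤-refl All.∷ All.[]) (pos o ℓ) ℓ-right)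

map-cover : ∀ g σ → (∀ {i j} → σ ! i < σ ! j → g (σ ! i) < g (σ ! j)) → Cover σ (map g σ)
map-cover g σ g-mono = record
  { embedding = mapEmbedding g σ g-mono
  ; convex = λ {_} {_} {m} _ _ → mapPos-onto g σ m
  ; covers = λ _ o a → mapPos-onto g σ (pos o a) }

tail-inImage : ∀ {s σ x ρ} (o : Occ (s ∷ σ) (x ∷ ρ)) → pos o zero ≢ zero →
  ∀ a → InImage (rightEmbedding [ x ] ρ) (pos o a)
tail-inImage {x = x} {ρ} o first≢0 a =
  rightPos-onto [ x ] ρ (pos o a) (≤-trans (first≥1 (pos o zero) first≢0) (pos-mono o z≤n))
  where
  first≥1 : ∀ {m} (j : Fin (suc m)) → j ≢ zero → 1 ≤ toℕ j
  first≥1 zero j≢0 = ⊥-elim (j≢0 refl)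
  first≥1 (suc j) _ = s≤s z≤n

tailOcc : ∀ {s σ x ρ} (o : Occ (s ∷ σ) (x ∷ ρ)) → pos o zero ≢ zero → Occ (s ∷ σ) ρ
tailOcc {x = x} {ρ} o first≢0 = restrictOcc (rightEmbedding [ x ] ρ) o (tail-inImage o first≢0)

TSS-∷ : ∀ {x ρ} → TwoStackSortable ρ →
  (∀ (o : Occ p2341 (x ∷ ρ)) → pos o zero ≡ zero → ⊥) →
  (∀ (o : Occ p3241 (x ∷ ρ)) → pos o zero ≡ zero → Extends (x ∷ ρ) o) →
  TwoStackSortable (x ∷ ρ)
TSS-∷ {x} {ρ} (avoid2341 , extend3241) 2341-at-0 3241-at-0 = avoid , extend
  where
  avoid : Avoids p2341 (x ∷ ρ)
  avoid o with pos o zero F.≟ zero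
  ... | yes first≡0 = 2341-at-0 o first≡0
  ... | no first≢0 = avoid2341 (tailOcc o first≢0)
  extend : ∀ o → Extends (x ∷ ρ) o
  extend o with pos o zero F.≟ zero
  ... | yes first≡0 = 3241-at-0 o first≡0
  ... | no first≢0 = extends-embed (rightEmbedding [ x ] ρ) o (tailOcc o first≢0)
    (λ a → proj₂ (tail-inImage o first≢0 a)) (extend3241 (tailOcc o first≢0))

oneTo : ℕ → List ℕ
oneTo n = map suc (upTo n)

oneTo-suc : ∀ n → oneTo (suc n) ≡ oneTo n ∷ʳ suc n
oneTo-suc n = trans (cong (map suc) (sym (upTo-∷ʳ n))) (map-++ suc (upTo n) [ n ])

∈-oneTo⁻ : ∀ {n x} → x ∈ oneTo n → 1 ≤ x × x ≤ n
∈-oneTo⁻ x∈ with ∈-map⁻ suc x∈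
... | _ , y∈ , refl = s≤s z≤n , ∈-upTo⁻ y∈

∈-oneTo⁺ : ∀ {n x} → 1 ≤ x → x ≤ n → x ∈ oneTo n
∈-oneTo⁺ {x = suc x} _ x≤n = ∈-map⁺ suc (∈-upTo⁺ x≤n)

oneTo-bounded : ∀ n → All (λ x → 1 ≤ x × x ≤ n) (oneTo n)
oneTo-bounded n = All.tabulate ∈-oneTo⁻

lookup-injective : ∀ {xs : List ℕ} → Unique xs → ∀ {i j} → xs ! i ≡ xs ! j → i ≡ j
lookup-injective (_ AllPairs.∷ _) {zero} {zero} _ = refl
lookup-injective (x∉ AllPairs.∷ _) {zero} {suc j} eq = ⊥-elim (All.lookup x∉ (∈-lookup j) eq)
lookup-injective (x∉ AllPairs.∷ _) {suc i} {zero} eq = ⊥-elim (All.lookup x∉ (∈-lookup i) (sym eq))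
lookup-injective (_ AllPairs.∷ u) {suc i} {suc j} eq = cong suc (lookup-injective u eq)

module _ {n π} (perm : IsPerm n π) where

  IsPerm-length : length π ≡ n
  IsPerm-length = trans (↭-length perm) (trans (length-map suc (upTo n)) (length-upTo n))

  IsPerm-bounded : All (λ x → 1 ≤ x × x ≤ n) π
  IsPerm-bounded = All-resp-↭ (↭-sym perm) (oneTo-bounded n)

  IsPerm-below : All (_< suc n) π
  IsPerm-below = All.map (s≤s ∘ proj₂) IsPerm-bounded

  IsPerm-entry : ∀ i → 1 ≤ π ! i × π ! i ≤ n
  IsPerm-entry i = All.lookup IsPerm-bounded (∈-lookup i)

  IsPerm-injective : ∀ {i j} → π ! i ≡ π ! j → i ≡ j
  IsPerm-injective = lookup-injective (Permutation.Unique-resp-↭ (setoid ℕ) (↭⇒↭ₛ (↭-sym perm))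
    (Unique.map⁺ suc-injective (Unique.upTo⁺ n)))

  IsPerm-onto : ∀ {x} → 1 ≤ x → x ≤ n → Σ (Fin (length π)) λ i → π ! i ≡ x
  IsPerm-onto 1≤x x≤n =
    let x∈π = ∈-resp-↭ (↭-sym perm) (∈-oneTo⁺ 1≤x x≤n) in index x∈π , sym (lookup-index x∈π)

IsPerm-∷ : ∀ {n σ} → IsPerm n σ → IsPerm (suc n) (suc n ∷ σ)
IsPerm-∷ {n} perm = ↭-trans (↭-prep _ perm) (↭-trans (∷↭∷ʳ _ _) (↭-reflexive (sym (oneTo-suc n))))

IsPerm-∷⁻ : ∀ {n σ} → IsPerm (suc n) (suc n ∷ σ) → IsPerm n σ
IsPerm-∷⁻ {n} perm =
  drop-∷ (↭-trans perm (↭-trans (↭-reflexive (oneTo-suc n)) (↭-sym (∷↭∷ʳ _ _))))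

IsPerm-∷ʳ : ∀ {n σ} → IsPerm n σ → IsPerm (suc n) (σ ∷ʳ suc n)
IsPerm-∷ʳ {n} perm = ↭-trans (++⁺ʳ _ perm) (↭-reflexive (sym (oneTo-suc n)))

IsPerm-∷ʳ⁻ : ∀ {n σ} → IsPerm (suc n) (σ ∷ʳ suc n) → IsPerm n σ
IsPerm-∷ʳ⁻ {n} {σ} perm = subst₂ _↭_ (++-identityʳ σ) (++-identityʳ (oneTo n))
  (drop-mid σ (oneTo n) (↭-trans perm (↭-reflexive (oneTo-suc n))))

Q-perm : ∀ {n π} → Q n π → IsPerm n π
Q-perm = proj₁ ∘ proj₁

132-through-second : ∀ {a b v τ} j → τ ! j ≡ v → a < v → v < b → Occ p132 (a ∷ b ∷ τ)
132-through-second {a} {b} {τ = τ} j τj≡v a<v v<b =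
  132-at (a ∷ b ∷ τ) zero (suc zero) (suc (suc j)) (s≤s z≤n) (s≤s (s≤s z≤n))
    (subst (a <_) (sym τj≡v) a<v) (subst (_< b) (sym τj≡v) v<b)

between-in-tail : ∀ {n a b v τ} → IsPerm n (a ∷ b ∷ τ) → a < v → v < b →
  Σ (Fin (length τ)) λ j → τ ! j ≡ v
between-in-tail perm a<v v<b
  with IsPerm-onto perm (≤-trans (s≤s z≤n) a<v) (≤-trans (<⇒≤ v<b) (proj₂ (IsPerm-entry perm (suc zero))))
... | zero , a≡v = ⊥-elim (<-irrefl a≡v a<v)
... | suc zero , b≡v = ⊥-elim (<-irrefl (sym b≡v) v<b)
... | suc (suc j) , τj≡v = j , τj≡v

prepend-max-bijection : ∀ m →
  BijOnto (Q m) (λ π → Q (suc m) π × (∃ λ τ → π ≡ suc m ∷ τ)) (suc m ∷_)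
prepend-max-bijection m = (λ σ q → Q-extend (cover (Q-perm q)) (IsPerm-∷ (Q-perm q)) q , σ , refl) ,
  (λ _ _ _ _ → ∷-injectiveʳ) , onto
  where
  cover : ∀ {σ} → IsPerm m σ → Cover σ (suc m ∷ σ)
  cover {σ} perm = prepend-cover [ suc m ] σ (≤-refl All.∷ All.[]) (IsPerm-below perm) (s≤s z≤n)
  onto : ∀ π → Q (suc m) π × (∃ λ τ → π ≡ suc m ∷ τ) →
    Σ (List ℕ) λ σ → Q m σ × suc m ∷ σ ≡ π
  onto .(suc m ∷ τ) (q , τ , refl) =
    let perm = IsPerm-∷⁻ (Q-perm q) in τ , Q-restrict (cover perm) perm q , refl

append-max-bijection : ∀ m →
  BijOnto (Q m) (λ π → Q (suc m) π × (∃ λ τ → π ≡ τ ++ [ suc m ])) (_∷ʳ suc m)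
append-max-bijection m = (λ σ q → Q-extend (cover (Q-perm q)) (IsPerm-∷ʳ (Q-perm q)) q , σ , refl) ,
  (λ σ τ _ _ → ∷ʳ-injectiveˡ σ τ) , onto
  where
  cover : ∀ {σ} → IsPerm m σ → Cover σ (σ ∷ʳ suc m)
  cover {σ} perm = append-cover σ (IsPerm-below perm)
  onto : ∀ π → Q (suc m) π × (∃ λ τ → π ≡ τ ++ [ suc m ]) →
    Σ (List ℕ) λ σ → Q m σ × σ ∷ʳ suc m ≡ π
  onto .(τ ∷ʳ suc m) (q , τ , refl) =
    let perm = IsPerm-∷ʳ⁻ (Q-perm q) in τ , Q-restrict (cover perm) perm q , refl

head<second-max : ∀ {n a τ} → IsPerm n (a ∷ n ∷ τ) → a < n
head<second-max perm =
  ≤∧≢⇒< (proj₂ (IsPerm-entry perm zero)) (λ a≡n → 0≢1 (IsPerm-injective perm a≡n))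
  where
  0≢1 : ∀ {k} → F.zero {suc k} ≢ suc zero
  0≢1 ()

head≡pred-max : ∀ {m a τ} → IsPerm (suc (suc m)) (a ∷ suc (suc m) ∷ τ) →
  ¬ NIn132 (suc (suc m)) (a ∷ suc (suc m) ∷ τ) → a ≡ suc m
head≡pred-max perm max∉132 with m≤n⇒m<n∨m≡n (≤-pred (head<second-max perm))
... | inj₂ a≡m+1 = a≡m+1
... | inj₁ a<m+1 with between-in-tail perm a<m+1 ≤-refl
... | j , τj≡m+1 = ⊥-elim (max∉132 (132-through-second j τj≡m+1 a<m+1 ≤-refl , suc zero , refl))

prepend-two-bijection : ∀ m → BijOnto (Q m)
  (λ π → Q (suc (suc m)) π × (Σ ℕ λ a → ∃ λ τ → π ≡ a ∷ suc (suc m) ∷ τ) ×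
         ¬ NIn132 (suc (suc m)) π)
  (λ σ → suc m ∷ suc (suc m) ∷ σ)
prepend-two-bijection m = into , (λ _ _ _ _ → ∷-injectiveʳ ∘ ∷-injectiveʳ) , onto
  where
  n = suc (suc m)
  perm⁺ : ∀ {σ} → IsPerm m σ → IsPerm n (suc m ∷ n ∷ σ)
  perm⁺ perm = ↭-trans (↭-swap _ _ ↭-refl) (IsPerm-∷ (IsPerm-∷ perm))
  perm⁻ : ∀ {σ} → IsPerm n (suc m ∷ n ∷ σ) → IsPerm m σ
  perm⁻ perm = IsPerm-∷⁻ (IsPerm-∷⁻ (↭-trans (↭-swap _ _ ↭-refl) perm))
  cover : ∀ {σ} → IsPerm m σ → Cover σ (suc m ∷ n ∷ σ)
  cover {σ} perm =
    prepend-cover (suc m ∷ n ∷ []) σ (≤-refl All.∷ n≤1+n _ All.∷ All.[]) (IsPerm-below perm) ≤-refl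
  max∉132 : ∀ {σ} → IsPerm m σ → ¬ NIn132 n (suc m ∷ n ∷ σ)
  max∉132 {σ} perm (o , a , o-a≡n) with covers (cover perm) watch132 o a
  ... | i , ιi≡ = <⇒≱ (subst (m <_) (sym σi≡n) (m<n⇒m<1+n ≤-refl)) (proj₂ (IsPerm-entry perm i))
    where
    σi≡n : σ ! i ≡ n
    σi≡n = trans (cong ((suc m ∷ n ∷ σ) !_) ιi≡) o-a≡n
  into : ∀ σ → Q m σ →
    Q n (suc m ∷ n ∷ σ) × (Σ ℕ λ a → ∃ λ τ → suc m ∷ n ∷ σ ≡ a ∷ n ∷ τ) ×
    ¬ NIn132 n (suc m ∷ n ∷ σ)
  into σ q = Q-extend (cover (Q-perm q)) (perm⁺ (Q-perm q)) q , (suc m , σ , refl) , max∉132 (Q-perm q)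
  onto : ∀ π → Q n π × (Σ ℕ λ a → ∃ λ τ → π ≡ a ∷ n ∷ τ) × ¬ NIn132 n π →
    Σ (List ℕ) λ σ → Q m σ × suc m ∷ n ∷ σ ≡ π
  onto .(a ∷ n ∷ τ) (q , (a , τ , refl) , max∉132′) with head≡pred-max (Q-perm q) max∉132′
  ... | refl = let perm = perm⁻ (Q-perm q) in τ , Q-restrict (cover perm) perm q , refl

replace₁ : ℕ → ℕ → ℕ → ℕ
replace₁ a b x = if x ≡ᵇ a then b else x

replace₁-hit : ∀ a b → replace₁ a b a ≡ b
replace₁-hit a b with a ≡ᵇ a | ≡⇒≡ᵇ a a refl
... | true | _ = refl

replace₁-miss : ∀ {a} b {x} → x ≢ a → replace₁ a b x ≡ x
replace₁-miss {a} b {x} x≢a with x ≡ᵇ a in eq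
... | false = refl
... | true = ⊥-elim (x≢a (≡ᵇ⇒≡ x a (subst T (sym eq) _)))

replace₁-mono : ∀ {c x y} → x < y → y ≤ c → replace₁ c (suc c) x < replace₁ c (suc c) y
replace₁-mono {c} {x} {y} x<y y≤c rewrite replace₁-miss (suc c) (<⇒≢ (<-≤-trans x<y y≤c)) with y ≟ c
... | yes refl rewrite replace₁-hit c (suc c) = m<n⇒m<1+n x<y
... | no y≢c rewrite replace₁-miss (suc c) y≢c = x<y

replace-fresh : ∀ {a} b {xs} → All (_≢ a) xs → replace a b xs ≡ xs
replace-fresh b fresh = map-id-local (All.map (replace₁-miss b) fresh)

replace-inverse : ∀ a b {xs} → All (_≢ b) xs → replace b a (replace a b xs) ≡ xs
replace-inverse a b {xs} b-fresh = trans (sym (map-∘ xs)) (map-id-local (All.map back b-fresh))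
  where
  back : ∀ {x} → x ≢ b → replace₁ b a (replace₁ a b x) ≡ x
  back {x} x≢b with x ≟ a
  ... | yes refl = trans (cong (replace₁ b a) (replace₁-hit a b)) (replace₁-hit b a)
  ... | no x≢a = trans (cong (replace₁ b a) (replace₁-miss b x≢a)) (replace₁-miss a x≢b)

replace-↭ : ∀ a b {xs ys} → xs ↭ a ∷ ys → All (_≢ a) ys → replace a b xs ↭ b ∷ ys
replace-↭ a b perm fresh =
  ↭-trans (map⁺ (replace₁ a b) perm) (↭-reflexive (cong₂ _∷_ (replace₁-hit a b) (replace-fresh b fresh)))

oneTo-fresh : ∀ {k x} → k < x → All (_≢ x) (oneTo k)
oneTo-fresh k<x = All.map (λ bounds → <⇒≢ (≤-<-trans (proj₂ bounds) k<x)) (oneTo-bounded _)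

peak-of-132 : ∀ {n a τ} → IsPerm n (a ∷ n ∷ τ) → NIn132 n (a ∷ n ∷ τ) → suc a < n
peak-of-132 {n} {a} {τ} perm (o , b , o-b≡n) = peak b o-b≡n
  where
  π = a ∷ n ∷ τ
  not-below : ∀ x y → π ! pos o x ≡ n → π ! pos o x < π ! pos o y → ⊥
  not-below x y ≡n lt =
    <-irrefl refl (<-≤-trans (subst (_< π ! pos o y) ≡n lt) (proj₂ (IsPerm-entry perm (pos o y))))
  peak : ∀ b → π ! pos o b ≡ n → suc a < n
  peak zero ≡n = ⊥-elim (not-below zero (suc zero) ≡n (orderL o zero (suc zero) (<ᵇ⇒< _ _ _)))
  peak (suc (suc zero)) ≡n =
    ⊥-elim (not-below (suc (suc zero)) (suc zero) ≡n (orderL o (suc (suc zero)) (suc zero) (<ᵇ⇒< _ _ _)))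
  peak (suc zero) ≡n = ≤-trans (s≤s a<v) (subst (π ! pos o (suc (suc zero)) <_) ≡n v<peak)
    where
    second≡1 : pos o (suc zero) ≡ suc zero
    second≡1 = IsPerm-injective perm ≡n
    first≡0 : pos o zero ≡ zero
    first≡0 = first-pos (pos o zero)
      (subst (λ j → toℕ (pos o zero) < toℕ j) second≡1 (incr o zero (suc zero) (s≤s z≤n)))
    a<v : a < π ! pos o (suc (suc zero))
    a<v = subst (λ j → π ! j < π ! pos o (suc (suc zero))) first≡0
      (orderL o zero (suc (suc zero)) (<ᵇ⇒< _ _ _))
    v<peak : π ! pos o (suc (suc zero)) < π ! pos o (suc zero)
    v<peak = orderL o (suc (suc zero)) (suc zero) (<ᵇ⇒< _ _ _)

module PeakAtSecond (k : ℕ) where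
  c d n : ℕ
  c = suc k
  d = suc c
  n = suc d

  c<n : c < n
  c<n = s≤s (n≤1+n c)

  shuffle : n ∷ c ∷ d ∷ oneTo k ↭ oneTo n
  shuffle = ↭-trans (↭-prep n (↭-swap c d ↭-refl)) (IsPerm-∷ (IsPerm-∷ (IsPerm-∷ ↭-refl)))

  IsPerm-peak : ∀ {τ} → τ ↭ d ∷ oneTo k → IsPerm n (c ∷ n ∷ τ)
  IsPerm-peak perm = ↭-trans (↭-swap c n ↭-refl) (↭-trans (↭-prep n (↭-prep c perm)) shuffle)

  IsPerm-peak⁻ : ∀ {τ} → IsPerm n (c ∷ n ∷ τ) → τ ↭ d ∷ oneTo k
  IsPerm-peak⁻ perm = drop-∷ (drop-∷ (↭-trans (↭-swap n c ↭-refl) (↭-trans perm (↭-sym shuffle))))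

  IsPerm-c : ∀ {σ} → IsPerm c σ → σ ↭ c ∷ oneTo k
  IsPerm-c perm = ↭-trans perm (↭-sym (IsPerm-∷ ↭-refl))

  module Image {σ} (perm : IsPerm c σ) where
    σ′ ρ π₀ : List ℕ
    σ′ = replace c d σ
    ρ = n ∷ σ′
    π₀ = c ∷ ρ

    σ′-perm : σ′ ↭ d ∷ oneTo k
    σ′-perm = replace-↭ c d (IsPerm-c perm) (oneTo-fresh ≤-refl)

    perm₀ : IsPerm n π₀
    perm₀ = IsPerm-peak σ′-perm

    σ′-≤d : All (_≤ d) σ′
    σ′-≤d = All-resp-↭ (↭-sym σ′-perm)
      (≤-refl All.∷ All.map (λ bounds → ≤-trans (proj₂ bounds) (≤-trans (n≤1+n k) (n≤1+n c)))
                             (oneTo-bounded k))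

    cover : Cover σ ρ
    cover = cover-trans
      (map-cover (replace₁ c d) σ (λ {_} {j} lt → replace₁-mono lt (proj₂ (IsPerm-entry perm j))))
      (prepend-cover [ n ] σ′ (≤-refl All.∷ All.[]) (All.map s≤s σ′-≤d) (s≤s z≤n))

    tail-≤d : ∀ j → 2 ≤ toℕ j → π₀ ! j ≤ d
    tail-≤d (suc zero) (s≤s ())
    tail-≤d (suc (suc i)) _ = All.lookup σ′-≤d (∈-lookup i)

    below-n⇒tail : ∀ j → 1 ≤ toℕ j → π₀ ! j < n → 2 ≤ toℕ j
    below-n⇒tail (suc zero) _ n<n = ⊥-elim (<-irrefl refl n<n)
    below-n⇒tail (suc (suc i)) _ _ = s≤s (s≤s z≤n)

    no2341-at-0 : ∀ (o : Occ p2341 π₀) → pos o zero ≡ zero → ⊥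
    no2341-at-0 o first≡0 =
      <-irrefl refl (≤-trans (s≤s c<x) (≤-trans x<y (tail-≤d _ (index≤pos o (suc (suc zero))))))
      where
      c<x : c < π₀ ! pos o (suc zero)
      c<x = subst (λ j → π₀ ! j < π₀ ! pos o (suc zero)) first≡0
        (orderL o zero (suc zero) (<ᵇ⇒< _ _ _))
      x<y : π₀ ! pos o (suc zero) < π₀ ! pos o (suc (suc zero))
      x<y = orderL o (suc zero) (suc (suc zero)) (<ᵇ⇒< _ _ _)

    3241-at-0 : ∀ (o : Occ p3241 π₀) → pos o zero ≡ zero → Extends π₀ o
    3241-at-0 o first≡0 =
      suc zero , subst (λ j → toℕ j < 1) (sym first≡0) (s≤s z≤n) ,
      below-n⇒tail _ (index≤pos o (suc zero)) (<-trans second<c c<n) ,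
      s≤s (tail-≤d _ (index≤pos o (suc (suc zero))))
      where
      second<c : π₀ ! pos o (suc zero) < c
      second<c = subst (λ j → π₀ ! pos o (suc zero) < π₀ ! j) first≡0
        (orderL o (suc zero) zero (<ᵇ⇒< _ _ _))

    TSS₀ : TwoStackSortable σ → TwoStackSortable π₀
    TSS₀ tss = TSS-∷ (TSS-extend cover tss) no2341-at-0 3241-at-0

    TSS₀⁻ : TwoStackSortable π₀ → TwoStackSortable σ
    TSS₀⁻ tss = TSS-restrict (embedding cover) (convex cover)
      (TSS-restrict (rightEmbedding [ c ] ρ) (rightEmbedding-convex [ c ] ρ) tss)

    d-position : Σ (Fin (length σ′)) λ j → σ′ ! j ≡ d
    d-position = between-in-tail perm₀ (n<1+n c) ≤-refl

    O₀ : Occ p132 π₀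
    O₀ = 132-through-second (proj₁ d-position) (proj₂ d-position) (n<1+n c) ≤-refl

    unique₀ : Avoids p132 σ → ∀ o → pos o ≗ pos O₀
    unique₀ avoid o with pos o zero F.≟ zero
    ... | no first≢0 = ⊥-elim (avoid (restrictWatched cover watch132 (tailOcc o first≢0)))
    ... | yes first≡0 = λ
      { zero → first≡0
      ; (suc zero) → IsPerm-injective perm₀ second≡n
      ; (suc (suc zero)) → IsPerm-injective perm₀ (trans third≡d (sym (proj₂ d-position))) }
      where
      third≡d : π₀ ! pos o (suc (suc zero)) ≡ d
      third≡d = ≤-antisym (tail-≤d _ (index≤pos o (suc (suc zero))))
        (subst (λ j → π₀ ! j < π₀ ! pos o (suc (suc zero))) first≡0
          (orderL o zero (suc (suc zero)) (<ᵇ⇒< _ _ _)))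
      second≡n : π₀ ! pos o (suc zero) ≡ n
      second≡n = ≤-antisym (proj₂ (IsPerm-entry perm₀ (pos o (suc zero))))
        (subst (_< π₀ ! pos o (suc zero)) third≡d (orderL o (suc (suc zero)) (suc zero) (<ᵇ⇒< _ _ _)))

    avoid₀⁻ : ExactlyOne p132 π₀ → Avoids p132 σ
    avoid₀⁻ (_ , unique) o = 2+≢1 (trans (unique o₀ (suc zero)) (sym (unique O₀ (suc zero))))
      where
      o₀ : Occ p132 π₀
      o₀ = embedOcc (rightEmbedding [ c ] ρ) (embedOcc (embedding cover) o)
      2+≢1 : ∀ {m} {j : Fin m} → Fin.suc (Fin.suc j) ≢ Fin.suc Fin.zero
      2+≢1 ()

  head≡c : ∀ {a τ} → Q n (a ∷ n ∷ τ) → NIn132 n (a ∷ n ∷ τ) → a ≡ c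
  head≡c {a} {τ} ((perm , _) , _ , unique) peak
    with m≤n⇒m<n∨m≡n (≤-pred (≤-pred (peak-of-132 perm peak)))
  ... | inj₂ a≡c = a≡c
  ... | inj₁ a<c with between-in-tail perm a<c c<n | between-in-tail perm (m<n⇒m<1+n a<c) ≤-refl
  ... | jc , τjc≡c | jd , τjd≡d =
    ⊥-elim (<-irrefl (trans (sym τjc≡c) (trans (cong (τ !_) jc≡jd) τjd≡d)) (n<1+n c))
    where
    jc≡jd : jc ≡ jd
    jc≡jd = F.suc-injective (F.suc-injective (trans
      (unique (132-through-second jc τjc≡c a<c c<n) (suc (suc zero)))
      (sym (unique (132-through-second jd τjd≡d (m<n⇒m<1+n a<c) ≤-refl) (suc (suc zero))))))

  peak-bijection :
    BijOnto (P132 c) (λ π → Q n π × (Σ ℕ λ a → ∃ λ τ → π ≡ a ∷ n ∷ τ) × NIn132 n π)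
      (λ σ → c ∷ n ∷ replace c d σ)
  peak-bijection = into , injective , onto
    where
    into : ∀ σ → P132 c σ → Q n (c ∷ n ∷ replace c d σ) ×
      (Σ ℕ λ a → ∃ λ τ → c ∷ n ∷ replace c d σ ≡ a ∷ n ∷ τ) ×
      NIn132 n (c ∷ n ∷ replace c d σ)
    into σ ((perm , tss) , avoid) =
      ((perm₀ , TSS₀ tss) , O₀ , unique₀ avoid) , (c , σ′ , refl) , (O₀ , suc zero , refl)
      where open Image perm
    d-fresh : ∀ {σ} → IsPerm c σ → All (_≢ d) σ
    d-fresh perm =
      All-resp-↭ (↭-sym (IsPerm-c perm)) (<⇒≢ ≤-refl All.∷ oneTo-fresh (m<n⇒m<1+n (n<1+n k)))
    injective : ∀ σ τ → P132 c σ → P132 c τ →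
      c ∷ n ∷ replace c d σ ≡ c ∷ n ∷ replace c d τ → σ ≡ τ
    injective σ τ ((pσ , _) , _) ((pτ , _) , _) eq = begin
      σ                          ≡⟨ sym (replace-inverse c d (d-fresh pσ)) ⟩
      replace d c (replace c d σ) ≡⟨ cong (replace d c) (∷-injectiveʳ (∷-injectiveʳ eq)) ⟩
      replace d c (replace c d τ) ≡⟨ replace-inverse c d (d-fresh pτ) ⟩
      τ                          ∎
      where open ≡-Reasoning
    onto : ∀ π → Q n π × (Σ ℕ λ a → ∃ λ τ → π ≡ a ∷ n ∷ τ) × NIn132 n π →
      Σ (List ℕ) λ σ → P132 c σ × c ∷ n ∷ replace c d σ ≡ π
    onto .(a ∷ n ∷ τ) (q , (a , τ , refl) , peak) with head≡c q peak
    ... | refl =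
      σ , ((perm , TSS₀⁻ (proj₂ (proj₁ q′))) , avoid₀⁻ (proj₂ q′)) , cong (λ τ′ → c ∷ n ∷ τ′) σ′≡τ
      where
      τ-perm = IsPerm-peak⁻ (Q-perm q)
      σ = replace d c τ
      perm : IsPerm c σ
      perm = ↭-trans (replace-↭ d c τ-perm (oneTo-fresh (m<n⇒m<1+n (n<1+n k)))) (IsPerm-∷ ↭-refl)
      σ′≡τ : replace c d σ ≡ τ
      σ′≡τ = replace-inverse d c
        (All-resp-↭ (↭-sym τ-perm) ((λ d≡c → <-irrefl (sym d≡c) (n<1+n c)) All.∷ oneTo-fresh (n<1+n k)))
      open Image perm
      q′ : Q n π₀
      q′ = subst (λ τ′ → Q n (c ∷ n ∷ τ′)) (sym σ′≡τ) q

module AroundMax {n π} (perm : IsPerm n π) (tss : TwoStackSortable π) (unique : ExactlyOne p132 π)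
                 (p : Fin (length π)) (π!p≡n : π ! p ≡ n) where

  below-max : ∀ {j} → j ≢ p → π ! j < π ! p
  below-max j≢p =
    ≤∧≢⇒< (subst (_ ≤_) (sym π!p≡n) (proj₂ (IsPerm-entry perm _))) (j≢p ∘ IsPerm-injective perm)

  <⇒≢ᶠ : ∀ {i j : Fin (length π)} → i F.< j → i ≢ j
  <⇒≢ᶠ i<j refl = <-irrefl refl i<j

  compare : ∀ {i k : Fin (length π)} → i ≢ k → π ! i < π ! k ⊎ π ! k < π ! i
  compare {i} {k} i≢k with <-cmp (π ! i) (π ! k)
  ... | tri< lt _ _ = inj₁ lt
  ... | tri≈ _ eq _ = ⊥-elim (i≢k (IsPerm-injective perm eq))
  ... | tri> _ _ gt = inj₂ gt

  132-through-max : ∀ {i k} → i F.< p → p F.< k → π ! i < π ! k → Occ p132 π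
  132-through-max {i} {k} i<p p<k πi<πk = 132-at π i p k i<p p<k πi<πk (below-max (<⇒≢ᶠ p<k ∘ sym))

  no-two-above : ∀ {i j k} → i F.< j → j F.< p → p F.< k → π ! k < π ! i → π ! k < π ! j → ⊥
  no-two-above {i} {j} {k} i<j j<p p<k πk<πi πk<πj with compare (<⇒≢ᶠ i<j)
  ... | inj₁ πi<πj = proj₁ tss (2341-at π i j p k i<j j<p p<k πk<πi πi<πj (below-max (<⇒≢ᶠ j<p)))
  ... | inj₂ πj<πi
    with proj₂ tss (3241-at π i j p k i<j j<p p<k πk<πj πj<πi (below-max (<⇒≢ᶠ (<-trans i<j j<p))))
  ... | m , _ , _ , πp<πm = <⇒≱ πp<πm (subst (_ ≤_) (sym π!p≡n) (proj₂ (IsPerm-entry perm m)))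

  at-most-one-below : ∀ {i i′ k} → i F.< p → i′ F.< p → p F.< k →
    π ! i < π ! k → π ! i′ < π ! k → i ≡ i′
  at-most-one-below i<p i′<p p<k πi<πk πi′<πk = trans (proj₂ unique (132-through-max i<p p<k πi<πk) zero)
    (sym (proj₂ unique (132-through-max i′<p p<k πi′<πk) zero))

  some-below : ∀ {i j k} → i F.< j → j F.< p → p F.< k →
    Σ (Fin (length π)) λ y → y F.< p × π ! y < π ! k
  some-below {i} {j} {k} i<j j<p p<k
    with compare (<⇒≢ᶠ (<-trans (<-trans i<j j<p) p<k)) | compare (<⇒≢ᶠ (<-trans j<p p<k))
  ... | inj₁ πi<πk | _ = i , <-trans i<j j<p , πi<πk
  ... | inj₂ _ | inj₁ πj<πk = j , j<p , πj<πk
  ... | inj₂ πk<πi | inj₂ πk<πj = ⊥-elim (no-two-above i<j j<p p<k πk<πi πk<πj)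

  three-before-one-after : ∀ {i j l k} → i F.< j → j F.< l → l F.< p → p F.< k → ⊥
  three-before-one-after {i} {j} {l} {k} i<j j<l l<p p<k
    with compare (<⇒≢ᶠ (<-trans (<-trans i<j j<l) (<-trans l<p p<k)))
       | compare (<⇒≢ᶠ (<-trans j<l (<-trans l<p p<k)))
       | compare (<⇒≢ᶠ (<-trans l<p p<k))
  ... | inj₁ πi<πk | inj₁ πj<πk | _ = <⇒≢ᶠ i<j (at-most-one-below i<p j<p p<k πi<πk πj<πk)
    where i<p = <-trans (<-trans i<j j<l) l<p ; j<p = <-trans j<l l<p
  ... | inj₁ πi<πk | inj₂ _ | inj₁ πl<πk =
    <⇒≢ᶠ (<-trans i<j j<l) (at-most-one-below (<-trans (<-trans i<j j<l) l<p) l<p p<k πi<πk πl<πk)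
  ... | inj₂ _ | inj₁ πj<πk | inj₁ πl<πk =
    <⇒≢ᶠ j<l (at-most-one-below (<-trans j<l l<p) l<p p<k πj<πk πl<πk)
  ... | inj₁ _ | inj₂ πk<πj | inj₂ πk<πl = no-two-above j<l l<p p<k πk<πj πk<πl
  ... | inj₂ πk<πi | inj₁ _ | inj₂ πk<πl = no-two-above (<-trans i<j j<l) l<p p<k πk<πi πk<πl
  ... | inj₂ πk<πi | inj₂ πk<πj | _ = no-two-above i<j (<-trans j<l l<p) p<k πk<πi πk<πj

  two-before-two-after : ∀ {i j k k′} → i F.< j → j F.< p → p F.< k → k F.< k′ → ⊥
  two-before-two-after i<j j<p p<k k<k′ with some-below i<j j<p p<k | some-below i<j j<p (<-trans p<k k<k′)
  ... | y , y<p , πy<πk | y′ , y′<p , πy′<πk′ = <⇒≢ᶠ k<k′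
    (trans (proj₂ unique (132-through-max y<p p<k πy<πk) (suc (suc zero)))
      (sym (proj₂ unique (132-through-max y′<p (<-trans p<k k<k′) πy′<πk′) (suc (suc zero)))))

MaxPlacement : ℕ → List ℕ → Set
MaxPlacement n π = (∃ λ τ → π ≡ n ∷ τ) ⊎ (Σ ℕ λ a → ∃ λ τ → π ≡ a ∷ n ∷ τ) ⊎
  (∃ λ τ → π ≡ τ ++ [ n ]) ⊎ (π ≡ 3 ∷ 1 ∷ 4 ∷ 2 ∷ [])

next-or-last : ∀ (π : List ℕ) (p : Fin (length π)) →
  (Σ (Fin (length π)) λ k → p F.< k) ⊎ (∃ λ τ → π ≡ τ ∷ʳ π ! p)
next-or-last (x ∷ []) zero = inj₂ ([] , refl)
next-or-last (x ∷ y ∷ π) zero = inj₁ (suc zero , s≤s z≤n)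
next-or-last (x ∷ π) (suc p) with next-or-last π p
... | inj₁ (k , p<k) = inj₁ (suc k , s≤s p<k)
... | inj₂ (τ , π≡) = inj₂ (x ∷ τ , cong (x ∷_) π≡)

squeeze-1<2<3 : ∀ {a b c} → 1 ≤ a → a < b → b < c → c ≤ 3 → a ≡ 1 × b ≡ 2 × c ≡ 3
squeeze-1<2<3 1≤a a<b b<c c≤3 = a≡1 , b≡2 , c≡3
  where
  c≡3 = ≤-antisym c≤3 (≤-trans (s≤s (≤-trans (s≤s 1≤a) a<b)) b<c)
  b≡2 = ≤-antisym (≤-pred (subst (_ <_) c≡3 b<c)) (≤-trans (s≤s 1≤a) a<b)
  a≡1 = ≤-antisym (≤-pred (subst (_ <_) b≡2 a<b)) 1≤a

module _ {x y w} (perm : IsPerm 4 (x ∷ y ∷ 4 ∷ w ∷ [])) (tss : TwoStackSortable (x ∷ y ∷ 4 ∷ w ∷ []))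
         (unique : ExactlyOne p132 (x ∷ y ∷ 4 ∷ w ∷ [])) where
  open AroundMax perm tss unique (suc (suc zero)) refl

  max-third-of-four : x ∷ y ∷ 4 ∷ w ∷ [] ≡ 3 ∷ 1 ∷ 4 ∷ 2 ∷ []
  max-third-of-four
    with compare {zero} {suc (suc (suc zero))} (λ ()) | compare {suc zero} {suc (suc (suc zero))} (λ ())
  ... | inj₁ x<w | inj₁ y<w =
    ⊥-elim (0≢1 (at-most-one-below (s≤s z≤n) (s≤s (s≤s z≤n)) ≤-refl x<w y<w))
    where
    0≢1 : F.zero {3} ≢ suc zero
    0≢1 ()
  ... | inj₂ w<x | inj₂ w<y = ⊥-elim (no-two-above (s≤s z≤n) (s≤s (s≤s z≤n)) ≤-refl w<x w<y)
  ... | inj₁ x<w | inj₂ w<y =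
    ⊥-elim (1≢2 (trans (proj₂ unique via-y (suc zero)) (sym (proj₂ unique via-max (suc zero)))))
    where
    via-y via-max : Occ p132 (x ∷ y ∷ 4 ∷ w ∷ [])
    via-y = 132-at _ zero (suc zero) (suc (suc (suc zero))) (s≤s z≤n) (s≤s (s≤s z≤n)) x<w w<y
    via-max = 132-through-max (s≤s z≤n) ≤-refl x<w
    1≢2 : suc zero ≢ F.suc {3} (suc zero)
    1≢2 ()
  ... | inj₂ w<x | inj₁ y<w
    with squeeze-1<2<3 (proj₁ (IsPerm-entry perm (suc zero))) y<w w<x (≤-pred (below-max {zero} (λ ())))
  ... | refl , refl , refl = refl

max-placement : ∀ {n} π → IsPerm n π → TwoStackSortable π → ExactlyOne p132 π →
  ∀ p → π ! p ≡ n → MaxPlacement n π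
max-placement (x ∷ τ) _ _ _ zero refl = inj₁ (τ , refl)
max-placement (x ∷ y ∷ τ) _ _ _ (suc zero) refl = inj₂ (inj₁ (x , τ , refl))
max-placement (x ∷ y ∷ z ∷ []) _ _ _ (suc (suc zero)) refl = inj₂ (inj₂ (inj₁ (x ∷ y ∷ [] , refl)))
max-placement (x ∷ y ∷ z ∷ w ∷ []) perm tss unique (suc (suc zero)) refl with IsPerm-length perm
... | refl = inj₂ (inj₂ (inj₂ (max-third-of-four perm tss unique)))
max-placement (x ∷ y ∷ z ∷ w ∷ v ∷ τ) perm tss unique (suc (suc zero)) refl =
  ⊥-elim (AroundMax.two-before-two-after perm tss unique (suc (suc zero)) refl
    (s≤s z≤n) (s≤s (s≤s z≤n)) ≤-refl ≤-refl)
max-placement π@(_ ∷ _ ∷ _ ∷ _) perm tss unique p@(suc (suc (suc _))) π!p≡n with next-or-last π p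
... | inj₁ (k , p<k) = ⊥-elim (AroundMax.three-before-one-after perm tss unique p π!p≡n
        (s≤s z≤n) (s≤s (s≤s z≤n)) (s≤s (s≤s (s≤s z≤n))) p<k)
... | inj₂ (τ , π≡) = inj₂ (inj₂ (inj₁ (τ , trans π≡ (cong (τ ∷ʳ_) π!p≡n))))

Q-max-placement : ∀ {n} → 1 ≤ n → ∀ π → Q n π → MaxPlacement n π
Q-max-placement 1≤n π ((perm , tss) , unique) =
  let p , π!p≡n = IsPerm-onto perm 1≤n ≤-refl in max-placement π perm tss unique p π!p≡n

mainTheorem18 : ∀ (n : ℕ) → 3 ≤ n →
    (∀ (π : List ℕ) → Q n π →
        (∃ λ τ → π ≡ n ∷ τ) ⊎ (Σ ℕ λ a → ∃ λ τ → π ≡ a ∷ n ∷ τ) ⊎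
        (∃ λ τ → π ≡ τ ++ [ n ]) ⊎ (π ≡ 3 ∷ 1 ∷ 4 ∷ 2 ∷ [])) ×
    BijOnto (Q (n ∸ 1)) (λ π → Q n π × (∃ λ τ → π ≡ n ∷ τ)) (λ σ → n ∷ σ) ×
    BijOnto (Q (n ∸ 2))
      (λ π → Q n π × (Σ ℕ λ a → ∃ λ τ → π ≡ a ∷ n ∷ τ) × ¬ NIn132 n π)
      (λ σ → (n ∸ 1) ∷ n ∷ σ) ×
    BijOnto (Q (n ∸ 1)) (λ π → Q n π × (∃ λ τ → π ≡ τ ++ [ n ])) (λ σ → σ ++ [ n ]) ×
    BijOnto (P132 (n ∸ 2))
      (λ π → Q n π × (Σ ℕ λ a → ∃ λ τ → π ≡ a ∷ n ∷ τ) × NIn132 n π)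
      (λ σ → (n ∸ 2) ∷ n ∷ replace (n ∸ 2) (n ∸ 1) σ)
mainTheorem18 (suc zero) (s≤s ())
mainTheorem18 (suc (suc zero)) (s≤s (s≤s ()))
mainTheorem18 (suc (suc (suc k))) _ =
  Q-max-placement (s≤s z≤n) ,
  prepend-max-bijection (suc (suc k)) ,
  prepend-two-bijection (suc k) ,
  append-max-bijection (suc (suc k)) ,
  PeakAtSecond.peak-bijection k
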